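{- Let $\gamma$ be an infinite limit ordinal and let $u=(\alpha,\beta)$ and $v=(\xi,0)$ be distinct vertices of $\mathcal G_\gamma$ with $0\leq\beta<\alpha<\xi$. If $\beta=0$ then $u\leq_1 v$, and if $0<\beta$ then $u\leq_\beta v$. In particular, $\eta(u,v)\leq\beta+1$.
   Context: $\mathcal G_\gamma$ is the graph with vertex set $\gamma\times\gamma$ in which two distinct vertices $(\alpha_0,\beta_0),(\alpha_1,\beta_1)$ are adjacent iff $\alpha_0=\alpha_1=0$, or $\beta_0=\beta_1=0$, or ($\alpha_0=\beta_0$ and $\alpha_1=\beta_1$), or ($\alpha_0<\alpha_1$ and $\beta_0>\beta_1$), or ($\alpha_0>\alpha_1$ and $\beta_0<\beta_1$). $N[v]$ is the closed neighbourhood of $v$. Relations $\leq_\alpha$ on the vertex set for ordinals $\alpha$: $u\leq_0 v$ iff $u=v$; $u\leq_\alpha v$ if for every $x\in N[u]$ there is $y\in N[v]$ with $x\leq_\delta y$ for some $\delta<\alpha$. $\eta(u,v)$ is the minimum ordinal $\alpha$ with $u\leq_\alpha v$. -}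

module Defs where

open import Level using (Level; _⊔_; suc)
open import Data.Product using (Σ; ∃; _×_; _,_)
open import Data.Sum using (_⊎_)
open import Relation.Binary.PropositionalEquality using (_≡_)
open import Relation.Binary.Definitions using (Trichotomous)
open import Relation.Binary.Structures using (IsStrictTotalOrder)
open import Induction.WellFounded using (WellFounded; module All)

-- An infinite limit ordinal γ, presented (as usual) by the set of its
-- elements, i.e. the ordinals below γ, with their (strict) ordering.
-- A nonempty well-order without a greatest element has order type an
-- infinite limit ordinal, and every infinite limit ordinal is such.
record InfLimitOrdinal (a ℓ : Level) : Set (suc (a ⊔ ℓ)) where
  field
    Ord        : Set a
    _<_        : Ord → Ord → Set ℓ
    isSTO      : IsStrictTotalOrder _≡_ _<_
    wf         : WellFounded _<_
    ozero      : Ord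
    ozero-min  : ∀ x → ozero ≡ x ⊎ ozero < x
    osuc       : Ord → Ord
    osuc-gt    : ∀ x → x < osuc x
    osuc-least : ∀ x y → y < osuc x → y < x ⊎ y ≡ x

  _≤_ : Ord → Ord → Set (a ⊔ ℓ)
  x ≤ y = x < y ⊎ x ≡ y

  one : Ord
  one = osuc ozero

  V : Set a
  V = Ord × Ord

  Adj : V → V → Set (a ⊔ ℓ)
  Adj (α₀ , β₀) (α₁ , β₁) =
    ¬≡ × ((α₀ ≡ ozero × α₁ ≡ ozero)
         ⊎ (β₀ ≡ ozero × β₁ ≡ ozero)
         ⊎ (α₀ ≡ β₀ × α₁ ≡ β₁)
         ⊎ (α₀ < α₁ × β₁ < β₀)
         ⊎ (α₁ < α₀ × β₀ < β₁))
    where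
      open import Relation.Nullary using (¬_)
      ¬≡ : Set a
      ¬≡ = ¬ ((α₀ , β₀) ≡ (α₁ , β₁))

  _∈N[_] : V → V → Set (a ⊔ ℓ)
  x ∈N[ u ] = x ≡ u ⊎ Adj u x

  -- One step of the definition of ≤_α, given ≤_δ for all δ < α:
  -- u ≤_0 v iff u = v;  u ≤_α v iff ∀ x ∈ N[u] ∃ y ∈ N[v] ∃ δ < α, x ≤_δ y.
  -- (For α = 0 the second clause is vacuously false since N[u] ∋ u.)
  LeStep : (α : Ord) → (∀ {δ} → δ < α → V → V → Set (a ⊔ ℓ)) → V → V → Set (a ⊔ ℓ)
  LeStep α rec u v =
    (α ≡ ozero × u ≡ v)
    ⊎ (∀ x → x ∈N[ u ] → Σ V λ y → y ∈N[ v ] × Σ Ord λ δ → Σ (δ < α) λ p → rec p x y)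

  Le : Ord → V → V → Set (a ⊔ ℓ)
  Le = All.wfRec wf (suc (a ⊔ ℓ)) (λ _ → V → V → Set (a ⊔ ℓ)) LeStep

  syntax Le α u v = u ≤[ α ] v

-- Every neighbour of u = (α , β) is already a neighbour of v = (ξ , 0),
-- except a south-east neighbour (x , y) with 0 < y < β.  Such a vertex lies
-- in the same configuration as u, with y < x < x + 1, so by induction on the
-- level it is ≤_y the vertex (x + 1 , 0), which lies on row 0 and hence in
-- N[v].  A single induction with level δ ≥ β covers both claims: δ = β
-- when 0 < β, and δ = 1 when β = 0 (then there are no such neighbours).
module Submission where

open import Defs
open import Level using (Level; _⊔_)
open import Data.Product using (Σ; _×_; _,_)
open import Data.Sum using (_⊎_; inj₁; inj₂)
open import Data.Empty using (⊥; ⊥-elim)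
open import Relation.Binary.PropositionalEquality using (_≡_; _≢_; refl; sym)
open import Relation.Binary.Structures using (IsStrictTotalOrder)
open import Relation.Binary.Definitions using (tri<; tri≈; tri>)
open import Induction.WellFounded using (Acc; acc; module Some)

module _ {a ℓ : Level} (G : InfLimitOrdinal a ℓ) where
  open InfLimitOrdinal G
  open IsStrictTotalOrder isSTO using (compare; trans; irrefl)

  -- Le unfolds only along an accessibility proof, so we work with this
  -- variant; Le δ is definitionally LeAcc δ (wf δ).
  LeAcc : (δ : Ord) → Acc _<_ δ → V → V → Set (a ⊔ ℓ)
  LeAcc = Some.wfRec (λ _ → V → V → Set (a ⊔ ℓ)) LeStep

  <-irrefl : ∀ {x} → x < x → ⊥
  <-irrefl = irrefl refl

  ≮ozero : ∀ {x} → x < ozero → ⊥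
  ≮ozero {x} x<0 with ozero-min x
  ... | inj₁ refl = <-irrefl x<0
  ... | inj₂ 0<x  = <-irrefl (trans x<0 0<x)

  <-≤-trans : ∀ {x y z} → x < y → y ≤ z → x < z
  <-≤-trans x<y (inj₁ y<z) = trans x<y y<z
  <-≤-trans x<y (inj₂ refl) = x<y

  LeAcc-refl₀ : (q : Acc _<_ ozero) (w : V) → LeAcc ozero q w w
  LeAcc-refl₀ q w = inj₁ (refl , refl)

  ≢-of-fst< : ∀ {x y z w : Ord} → x < y → (y , z) ≢ (x , w)
  ≢-of-fst< x<y refl = <-irrefl x<y

  row₀∈N : ∀ ξ x → (x , ozero) ∈N[ (ξ , ozero) ]
  row₀∈N ξ x with compare ξ x
  ... | tri≈ _ refl _ = inj₁ refl
  ... | tri< ξ<x _ _  = inj₂ ((λ e → ≢-of-fst< ξ<x (sym e)) , inj₂ (inj₁ (refl , refl)))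
  ... | tri> _ _ x<ξ  = inj₂ (≢-of-fst< x<ξ , inj₂ (inj₁ (refl , refl)))

  left-of∈N : ∀ {ξ x} y → x < ξ → (x , y) ∈N[ (ξ , ozero) ]
  left-of∈N {ξ} {x} y x<ξ with ozero-min y
  ... | inj₁ refl = row₀∈N ξ x
  ... | inj₂ 0<y  = inj₂ (≢-of-fst< x<ξ , inj₂ (inj₂ (inj₂ (inj₂ (x<ξ , 0<y)))))

  data Neighbour (α β : Ord) : V → Set (a ⊔ ℓ) where
    self       : Neighbour α β (α , β)
    on-row₀    : ∀ x → Neighbour α β (x , ozero)
    north-west : ∀ {x y} → x < α → β < y → Neighbour α β (x , y)
    south-east : ∀ {x y} → α < x → y < β → Neighbour α β (x , y)

  neighbour : ∀ {α β w} → β < α → w ∈N[ (α , β) ] → Neighbour α β w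
  neighbour             β<α (inj₁ refl)                                        = self
  neighbour {w = _ , _} β<α (inj₂ (_ , inj₁ (refl , _)))                       = ⊥-elim (≮ozero β<α)
  neighbour {w = _ , _} β<α (inj₂ (_ , inj₂ (inj₁ (_ , refl))))                = on-row₀ _
  neighbour {w = _ , _} β<α (inj₂ (_ , inj₂ (inj₂ (inj₁ (refl , _)))))         = ⊥-elim (<-irrefl β<α)
  neighbour {w = _ , _} β<α (inj₂ (_ , inj₂ (inj₂ (inj₂ (inj₁ (α<x , y<β)))))) = south-east α<x y<β
  neighbour {w = _ , _} β<α (inj₂ (_ , inj₂ (inj₂ (inj₂ (inj₂ (x<α , β<y)))))) = north-west x<α β<y

  LeAcc-row₀ : ∀ δ (q : Acc _<_ δ) → ozero < δ → ∀ {α β ξ} → β < α → α < ξ → β ≤ δ →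
           LeAcc δ q (α , β) (ξ , ozero)
  LeAcc-row₀ δ (acc rs) 0<δ {α} {β} {ξ} β<α α<ξ β≤δ =
    inj₂ λ w w∈N → dominate (neighbour β<α w∈N)
    where
    Dominated : V → Set (a ⊔ ℓ)
    Dominated w = Σ V λ w′ → w′ ∈N[ (ξ , ozero) ] ×
                  Σ Ord λ ε → Σ (ε < δ) λ ε<δ → LeAcc ε (rs ε<δ) w w′

    itself : ∀ {w} → w ∈N[ (ξ , ozero) ] → Dominated w
    itself {w} w∈N = w , w∈N , ozero , 0<δ , LeAcc-refl₀ (rs 0<δ) w

    dominate : ∀ {w} → Neighbour α β w → Dominated w
    dominate self                       = itself (left-of∈N β α<ξ)
    dominate (on-row₀ x)                = itself (row₀∈N ξ x)
    dominate (north-west {y = y} x<α _) = itself (left-of∈N y (trans x<α α<ξ))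
    dominate (south-east {x} {y} α<x y<β) with ozero-min y
    ... | inj₁ refl = itself (row₀∈N ξ x)
    ... | inj₂ 0<y  = (osuc x , ozero) , row₀∈N ξ (osuc x) , y , <-≤-trans y<β β≤δ ,
                      LeAcc-row₀ y (rs (<-≤-trans y<β β≤δ)) 0<y (trans y<β (trans β<α α<x)) (osuc-gt x) (inj₂ refl)

lemma2 : ∀ {a ℓ : Level} (G : InfLimitOrdinal a ℓ) → let open InfLimitOrdinal G in
    (α β ξ : Ord) → β < α → α < ξ →
    (β ≡ ozero → Le one (α , β) (ξ , ozero))
    × (ozero < β → Le β (α , β) (ξ , ozero))
    × Σ Ord (λ δ → δ ≤ osuc β × Le δ (α , β) (ξ , ozero))
lemma2 G α β ξ β<α α<ξ = at-one , at-β , η-bound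
  where
  open InfLimitOrdinal G

  at-one : β ≡ ozero → Le one (α , β) (ξ , ozero)
  at-one refl = LeAcc-row₀ G one (wf one) (osuc-gt ozero) β<α α<ξ (inj₁ (osuc-gt ozero))

  at-β : ozero < β → Le β (α , β) (ξ , ozero)
  at-β 0<β = LeAcc-row₀ G β (wf β) 0<β β<α α<ξ (inj₂ refl)

  η-bound : Σ Ord (λ δ → δ ≤ osuc β × Le δ (α , β) (ξ , ozero))
  η-bound with ozero-min β
  ... | inj₁ refl = one , inj₂ refl , at-one refl
  ... | inj₂ 0<β  = β , inj₁ (osuc-gt β) , at-β 0<β
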